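{- Let $n$ and $r$ be positive integers with $1<r<n$ and $n\ge 4$, and let $G$ be an $[n:n-r]$-graph with no isolated vertices. Then $G$ is a disconnected quasi $f$-graph of type $\left(0,\tfrac12(2n-r-r^2)\right)$.
   Context: For positive integers $m,n$, a graph $G$ is an $[m:n]$-graph if its complement $\overline{G}$ is the complete bipartite graph $K_{m,n}$ on $m+n$ vertices, i.e. $G$ is the disjoint union $K_m\sqcup K_n$ of complete graphs. Let $G$ have vertex set $V=\{v_1,\dots,v_N\}$, $k$ a field, $R=k[x_1,\dots,x_N]$, $x_F=\prod_{v_i\in F}x_i$. For a square-free monomial ideal $I\subseteq R$ with minimal generating set $G(I)$: the facet complex $\delta_{\mathcal F}(I)$ is the simplicial complex whose facets are the sets $\{v_{i_1},\dots,v_{i_r}\}$ with $x_{i_1}\cdots x_{i_r}\in G(I)$; the non-face complex $\delta_{\mathcal N}(I)$ is $\{F\subseteq V: x_F\notin I\}$. The $f$-vector of a $d$-dimensional complex is $(f_0,\dots,f_d)$, $f_i$ the number of faces with $i+1$ elements. $I$ is a quasi $f$-ideal of type $(a_1,\dots,a_s)\in\mathbb Z^s$ if $f(\delta_{\mathcal N}(I))-f(\delta_{\mathcal F}(I))=(a_1,\dots,a_s)$, both $f$-vectors lying in $\mathbb Z^s$. $G$ is a quasi $f$-graph of type $(0,b)$ if its edge ideal $I(G)=(x_ix_j:\{v_i,v_j\}\in E(G))$ is a quasi $f$-ideal of type $(0,b)$. -}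

module Defs where

open import Data.Nat using (ℕ; zero; suc; _≡ᵇ_; _⊔_)
open import Data.Integer using (ℤ; +_; _-_)
open import Data.Bool using (Bool; true; false; _∧_; not)
open import Data.Fin using (Fin)
open import Data.Fin.Subset using (Subset; _⊆_; _∪_; ⁅_⁆; ∣_∣)
open import Data.Fin.Subset.Properties using (_⊆?_; _⊂?_)
open import Data.List using (List; []; _∷_; _++_; map; length; filterᵇ; foldr; zipWith; upTo; allFin)
open import Data.Bool.ListAction using (any)
open import Data.Vec using (Vec; tabulate) renaming (_∷_ to _∷ᵥ_; [] to []ᵥ)
open import Data.Vec.Properties using (≡-dec)
import Data.Bool as B
open import Data.Product using (Σ; _×_)
open import Function.Bundles using (_⇔_)
open import Relation.Nullary using (¬_; ⌊_⌋)
open import Relation.Binary.PropositionalEquality using (_≡_; _≢_)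

record SimpleGraph (N : ℕ) : Set where
  field
    Adj    : Fin N → Fin N → Bool
    sym    : ∀ u v → Adj u v ≡ Adj v u
    irrefl : ∀ v → Adj v v ≡ false
open SimpleGraph public

ComplAdj : ∀ {N} → SimpleGraph N → Fin N → Fin N → Set
ComplAdj G u v = u ≢ v × Adj G u v ≡ false

-- G is an [m:n]-graph: its complement is (isomorphic to) K_{m,n}, i.e. the
-- vertices split into parts of sizes m and n and two vertices are adjacent
-- in the complement iff they lie in different parts.
Is[_∶_]-graph : ∀ {N} → ℕ → ℕ → SimpleGraph N → Set
Is[_∶_]-graph {N} m n G =
  Σ (Fin N → Bool) λ side →
    (∣ tabulate side ∣ ≡ m) × (∣ tabulate (λ v → not (side v)) ∣ ≡ n) ×
    (∀ u v → ComplAdj G u v ⇔ (side u ≢ side v))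

NoIsolatedVertices : ∀ {N} → SimpleGraph N → Set
NoIsolatedVertices {N} G = ∀ v → Σ (Fin N) λ u → Adj G v u ≡ true

data Reachable {N} (G : SimpleGraph N) : Fin N → Fin N → Set where
  here : ∀ {u} → Reachable G u u
  step : ∀ {u v w} → Adj G u v ≡ true → Reachable G v w → Reachable G u w

Connected : ∀ {N} → SimpleGraph N → Set
Connected G = ∀ u v → Reachable G u v

Disconnected : ∀ {N} → SimpleGraph N → Set
Disconnected G = ¬ Connected G

-- Subsets of the vertex set; x_F is represented by the subset F.

allSubsets : (n : ℕ) → List (Subset n)
allSubsets zero    = []ᵥ ∷ []
allSubsets (suc n) = map (true ∷ᵥ_) (allSubsets n) ++ map (false ∷ᵥ_) (allSubsets n)

countSubsets : ∀ {N} → (Subset N → Bool) → ℕ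
countSubsets {N} p = length (filterᵇ p (allSubsets N))

-- Square-free monomial ideals of R = k[x_1..x_N], given by a (decidable)
-- set of square-free monomial generators x_g.

record SqFreeMonomialIdeal (N : ℕ) : Set where
  field
    gens : Subset N → Bool
open SqFreeMonomialIdeal public

-- x_F ∈ I  iff some generator x_g divides x_F  (monomial ideal membership)
inIdeal : ∀ {N} → SqFreeMonomialIdeal N → Subset N → Bool
inIdeal {N} I F = any (λ g → gens I g ∧ ⌊ g ⊆? F ⌋) (allSubsets N)

minimalGen : ∀ {N} → SqFreeMonomialIdeal N → Subset N → Bool
minimalGen {N} I g =
  gens I g ∧ not (any (λ h → gens I h ∧ ⌊ h ⊂? g ⌋) (allSubsets N))

-- simplicial complexes on Fin N, as their (decidable) set of faces
Complex : ℕ → Set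
Complex N = Subset N → Bool

facetComplex : ∀ {N} → SqFreeMonomialIdeal N → Complex N
facetComplex {N} I F = any (λ g → minimalGen I g ∧ ⌊ F ⊆? g ⌋) (allSubsets N)

nonFaceComplex : ∀ {N} → SqFreeMonomialIdeal N → Complex N
nonFaceComplex I F = not (inIdeal I F)

-- largest face size = dim + 1
maxFaceSize : ∀ {N} → Complex N → ℕ
maxFaceSize {N} Δ = foldr _⊔_ 0 (map ∣_∣ (filterᵇ Δ (allSubsets N)))

-- f-vector (f_0, …, f_d), f_i = number of faces with i+1 elements
fVector : ∀ {N} → Complex N → List ℕ
fVector Δ = map (λ i → countSubsets (λ F → Δ F ∧ (∣ F ∣ ≡ᵇ suc i))) (upTo (maxFaceSize Δ))

IsQuasiFIdeal : ∀ {N} → SqFreeMonomialIdeal N → List ℤ → Set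
IsQuasiFIdeal I a =
  (length (fVector (nonFaceComplex I)) ≡ length a) ×
  (length (fVector (facetComplex I)) ≡ length a) ×
  (zipWith (λ x y → + x - + y) (fVector (nonFaceComplex I)) (fVector (facetComplex I)) ≡ a)

edgeIdeal : ∀ {N} → SimpleGraph N → SqFreeMonomialIdeal N
edgeIdeal {N} G = record
  { gens = λ F → any (λ i → any (λ j → Adj G i j ∧ ⌊ ≡-dec B._≟_ F (⁅ i ⁆ ∪ ⁅ j ⁆) ⌋) (allFin N)) (allFin N) }

IsQuasiFGraph : ∀ {N} → SimpleGraph N → List ℤ → Set
IsQuasiFGraph G a = IsQuasiFIdeal (edgeIdeal G) a

{-# OPTIONS --safe #-}
-- An [n : m]-graph G is the disjoint union of two cliques, the sides S and ∁ S of
-- sizes n and m = n ∸ r.  A square-free monomial x_F lies in the edge ideal I(G) iff F contains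
-- two vertices of one side, so the non-faces of I(G) are the sets meeting each side at most
-- once: the N vertices and the n·m cross pairs.  The facets of I(G) are the edges, so the
-- facet complex consists of the N vertices (none is isolated) and the C(n,2) + C(m,2) edges.
-- Both complexes are one-dimensional, their f₀ agree, and since 2·C(k,2) = k² − k,
-- 2 (n m − C(n,2) − C(m,2)) = 2n − r − r².  Edges never join the two sides, so G is
-- disconnected.
module Submission where

open import Defs hiding (sym)
open import Data.Bool using (Bool; true; false; T; T?; _∧_; _∨_; not)
import Data.Bool as Bool
open import Data.Bool.Properties using (T-∧; T-∨; T-≡; T-not-≡; ∧-zeroʳ; ¬-not)
open import Data.Bool.ListAction using (any)
open import Data.Empty using (⊥-elim)
open import Data.Fin using (Fin; zero; suc)
open import Data.Fin.Properties using (_≟_; suc-injective)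
open import Data.Fin.Subset using (Subset; inside; outside; _∈_; _⊆_; _⊂_; _∪_; _∩_; ∁; ⁅_⁆; ∣_∣; Nonempty)
open import Data.Fin.Subset.Properties
  using (_∈?_; _⊆?_; _⊂?_; p⊆q⇒∣p∣≤∣q∣; p⊂q⇒∣p∣<∣q∣; x∈p⇒∣p-x∣<∣p∣; x∈p∧x≢y⇒x∈p-y;
         x∈⁅x⁆; x∈⁅y⁆⇒x≡y; x∈p∪q⁺; x∈p∪q⁻; ∣⁅x⁆∣≡1; p⊆p∪q; x∈p∩q⁺; x∈p∩q⁻; x∈∁p⇒x∉p; x∉p⇒x∈∁p)
open import Data.List using (List; []; _∷_; _++_; map; length; filterᵇ; allFin; upTo; zipWith)
open import Data.List.Properties using (length-++; filter-++; filter-≐; foldr-preservesᵇ; foldr-preservesᵒ)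
open import Data.List.Membership.Propositional as List using (lose)
open import Data.List.Membership.Propositional.Properties using (∈-allFin; ∈-map⁺; ∈-++⁺ˡ; ∈-++⁺ʳ; ∈-filter⁺)
import Data.List.Relation.Unary.All as All
import Data.List.Relation.Unary.All.Properties as All
import Data.List.Relation.Unary.Any as Any
open import Data.List.Relation.Unary.Any using (satisfied) renaming (here to hereₗ)
open import Data.List.Relation.Unary.Any.Properties using (any⁺; any⁻)
open import Data.Nat using (ℕ; zero; suc; _+_; _*_; _∸_; _≤_; _<_; _≡ᵇ_; _<ᵇ_; z≤n; s≤s)
open import Data.Nat.Combinatorics using (_C_; nC1≡n; nCk+nC[k+1]≡[n+1]C[k+1])
open import Data.Nat.Properties
  using (≤-refl; ≤-trans; ≤-antisym; ≤-reflexive; <⇒≤; <⇒≱; ≤⇒≯; ≮⇒≥; n≤1+n; +-suc; +-mono-≤; +-monoʳ-≤;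
         *-identityʳ; *-identityˡ; *-distribʳ-+; *-distribˡ-+; m∸n+n≡m; m<n⇒0<n∸m; ⊔-lub; m≤m⊔n; m≤n⊔m;
         ≡ᵇ⇒≡; <⇒<ᵇ; <ᵇ⇒<)
open import Data.Integer using (ℤ; +_; _-_) renaming (_*_ to _*ℤ_; _+_ to _+ℤ_)
open import Data.Integer.Properties using (+-inverseʳ; pos-+; pos-*; *-cancelˡ-≡)
open import Data.Integer.Tactic.RingSolver using () renaming (solve-∀ to ℤ-solve-∀)
open import Data.Nat.Tactic.RingSolver using () renaming (solve-∀ to ℕ-solve-∀)
open import Data.Product using (∃; ∃₂; _×_; _,_; proj₁; proj₂)
open import Data.Sum using (_⊎_; inj₁; inj₂; [_,_]′)
import Data.Sum as Sum
open import Data.Vec using ([]; _∷_; here; there; tabulate)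
open import Data.Vec.Properties using (lookup∘tabulate; []=⇒lookup; lookup⇒[]=; tabulate-∘)
open import Function using (_∘_; _⇔_; mk⇔; Equivalence)
open import Relation.Binary.PropositionalEquality
open import Relation.Nullary using (¬_; yes; no; contradiction; ⌊_⌋)
open import Relation.Nullary.Decidable using (toWitness; fromWitness)

open Equivalence using (to; from)

private variable
  N : ℕ
  p q : Subset N
  x y : Fin N

T⇔T⇒≡ : ∀ {a b : Bool} → (T a → T b) → (T b → T a) → a ≡ b
T⇔T⇒≡ {false} {false} _ _ = refl
T⇔T⇒≡ {false} {true}  _ b⇒a = ⊥-elim (b⇒a _)
T⇔T⇒≡ {true}  {false} a⇒b _ = ⊥-elim (a⇒b _)
T⇔T⇒≡ {true}  {true}  _ _ = refl

¬T⇒T-not : ∀ {a : Bool} → ¬ T a → T (not a)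
¬T⇒T-not {false} _ = _
¬T⇒T-not {true} ¬a = ¬a _

∧-congʳ-T : ∀ {a b : Bool} c → (T c → a ≡ b) → a ∧ c ≡ b ∧ c
∧-congʳ-T {a} {b} false _   = trans (∧-zeroʳ a) (sym (∧-zeroʳ b))
∧-congʳ-T         true  a≡b = cong (_∧ true) (a≡b _)

T-any⇔∃ : ∀ {A : Set} (f : A → Bool) {xs : List A} → (∀ a → a List.∈ xs) →
          T (any f xs) ⇔ ∃ (T ∘ f)
T-any⇔∃ f {xs} complete =
  mk⇔ (satisfied ∘ any⁻ f xs) (λ (a , fa) → any⁺ f (lose (complete a) fa))

-- Finite subsets and counting

x∈p⇒0<∣p∣ : x ∈ p → 0 < ∣ p ∣
x∈p⇒0<∣p∣ x∈p = ≤-trans (s≤s z≤n) (x∈p⇒∣p-x∣<∣p∣ x∈p)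

x≢y⇒1<∣p∣ : x ≢ y → x ∈ p → y ∈ p → 1 < ∣ p ∣
x≢y⇒1<∣p∣ x≢y x∈p y∈p =
  ≤-trans (s≤s (x∈p⇒0<∣p∣ (x∈p∧x≢y⇒x∈p-y y∈p (x≢y ∘ sym)))) (x∈p⇒∣p-x∣<∣p∣ x∈p)

0<∣p∣⇒Nonempty : ∀ (p : Subset N) → 0 < ∣ p ∣ → Nonempty p
0<∣p∣⇒Nonempty (inside  ∷ p) _ = zero , here
0<∣p∣⇒Nonempty (outside ∷ p) h with 0<∣p∣⇒Nonempty p h
... | x , x∈p = suc x , there x∈p

1<∣p∣⇒x≢y : ∀ (p : Subset N) → 1 < ∣ p ∣ → ∃₂ λ x y → x ≢ y × x ∈ p × y ∈ p
1<∣p∣⇒x≢y (inside  ∷ p) (s≤s h) with 0<∣p∣⇒Nonempty p h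
... | y , y∈p = zero , suc y , (λ ()) , here , there y∈p
1<∣p∣⇒x≢y (outside ∷ p) h with 1<∣p∣⇒x≢y p h
... | x , y , x≢y , x∈p , y∈p = suc x , suc y , x≢y ∘ suc-injective , there x∈p , there y∈p

∣p∣≤1⇒p⊆⁅x⁆ : ∣ p ∣ ≤ 1 → x ∈ p → p ⊆ ⁅ x ⁆
∣p∣≤1⇒p⊆⁅x⁆ {x = x} ∣p∣≤1 x∈p {y} y∈p with y ≟ x
... | yes refl = x∈⁅x⁆ x
... | no  y≢x  = contradiction ∣p∣≤1 (<⇒≱ (x≢y⇒1<∣p∣ y≢x y∈p x∈p))

p⊆q∧∣q∣≤∣p∣⇒q⊆p : p ⊆ q → ∣ q ∣ ≤ ∣ p ∣ → q ⊆ p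
p⊆q∧∣q∣≤∣p∣⇒q⊆p {p = p} p⊆q ∣q∣≤∣p∣ {x} x∈q with x ∈? p
... | yes x∈p = x∈p
... | no  x∉p = contradiction (p⊂q⇒∣p∣<∣q∣ (p⊆q , x , x∈q , x∉p)) (≤⇒≯ ∣q∣≤∣p∣)

∣p∪q∣≤∣p∣+∣q∣ : ∀ (p q : Subset N) → ∣ p ∪ q ∣ ≤ ∣ p ∣ + ∣ q ∣
∣p∪q∣≤∣p∣+∣q∣ []            []            = z≤n
∣p∪q∣≤∣p∣+∣q∣ (inside  ∷ p) (inside  ∷ q) = s≤s (≤-trans (∣p∪q∣≤∣p∣+∣q∣ p q) (+-monoʳ-≤ ∣ p ∣ (n≤1+n ∣ q ∣)))
∣p∪q∣≤∣p∣+∣q∣ (inside  ∷ p) (outside ∷ q) = s≤s (∣p∪q∣≤∣p∣+∣q∣ p q)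
∣p∪q∣≤∣p∣+∣q∣ (outside ∷ p) (inside  ∷ q) = ≤-trans (s≤s (∣p∪q∣≤∣p∣+∣q∣ p q)) (≤-reflexive (sym (+-suc _ _)))
∣p∪q∣≤∣p∣+∣q∣ (outside ∷ p) (outside ∷ q) = ∣p∪q∣≤∣p∣+∣q∣ p q

∣p∣≡∣p∩q∣+∣p∩∁q∣ : ∀ (p q : Subset N) → ∣ p ∣ ≡ ∣ p ∩ q ∣ + ∣ p ∩ ∁ q ∣
∣p∣≡∣p∩q∣+∣p∩∁q∣ []            []            = refl
∣p∣≡∣p∩q∣+∣p∩∁q∣ (inside  ∷ p) (inside  ∷ q) = cong suc (∣p∣≡∣p∩q∣+∣p∩∁q∣ p q)
∣p∣≡∣p∩q∣+∣p∩∁q∣ (inside  ∷ p) (outside ∷ q) = trans (cong suc (∣p∣≡∣p∩q∣+∣p∩∁q∣ p q)) (sym (+-suc _ _))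
∣p∣≡∣p∩q∣+∣p∩∁q∣ (outside ∷ p) (_       ∷ q) = ∣p∣≡∣p∩q∣+∣p∩∁q∣ p q

countᵇ : ∀ {A : Set} → (A → Bool) → List A → ℕ
countᵇ f xs = length (filterᵇ f xs)

module _ {A : Set} where

  countᵇ-cong : ∀ {f g : A → Bool} → (∀ a → f a ≡ g a) → ∀ xs → countᵇ f xs ≡ countᵇ g xs
  countᵇ-cong f≗g xs =
    cong length (filter-≐ _ _ ((λ {a} → subst T (f≗g a)) , (λ {a} → subst T (sym (f≗g a)))) xs)

  countᵇ-false : ∀ (xs : List A) → countᵇ (λ _ → false) xs ≡ 0
  countᵇ-false []       = refl
  countᵇ-false (_ ∷ xs) = countᵇ-false xs

  countᵇ-++ : ∀ (f : A → Bool) xs ys → countᵇ f (xs ++ ys) ≡ countᵇ f xs + countᵇ f ys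
  countᵇ-++ f xs ys = trans (cong length (filter-++ _ xs ys)) (length-++ (filterᵇ f xs))

  countᵇ-map : ∀ {B : Set} (f : B → Bool) (g : A → B) xs → countᵇ f (map g xs) ≡ countᵇ (f ∘ g) xs
  countᵇ-map f g []       = refl
  countᵇ-map f g (a ∷ xs) with f (g a)
  ... | true  = cong suc (countᵇ-map f g xs)
  ... | false = countᵇ-map f g xs

  countᵇ-∨ : ∀ (f g : A → Bool) → (∀ a → f a ∧ g a ≡ false) →
             ∀ xs → countᵇ (λ a → f a ∨ g a) xs ≡ countᵇ f xs + countᵇ g xs
  countᵇ-∨ f g disjoint []       = refl
  countᵇ-∨ f g disjoint (a ∷ xs) with f a | g a | disjoint a
  ... | true  | false | _ = cong suc (countᵇ-∨ f g disjoint xs)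
  ... | false | true  | _ = trans (cong suc (countᵇ-∨ f g disjoint xs)) (sym (+-suc _ _))
  ... | false | false | _ = countᵇ-∨ f g disjoint xs

∈-allSubsets : ∀ (F : Subset N) → F List.∈ allSubsets N
∈-allSubsets []            = hereₗ refl
∈-allSubsets (inside  ∷ F) = ∈-++⁺ˡ (∈-map⁺ (inside ∷_) (∈-allSubsets F))
∈-allSubsets (outside ∷ F) = ∈-++⁺ʳ _ (∈-map⁺ (outside ∷_) (∈-allSubsets F))

countSubsets-suc : ∀ (f : Subset (suc N) → Bool) →
                   countSubsets f ≡ countSubsets (f ∘ (inside ∷_)) + countSubsets (f ∘ (outside ∷_))
countSubsets-suc {N} f = trans (countᵇ-++ f (map (inside ∷_) (allSubsets N)) _)
  (cong₂ _+_ (countᵇ-map f _ (allSubsets N)) (countᵇ-map f _ (allSubsets N)))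

meets : Subset N → ℕ → ℕ → Subset N → Bool
meets A i j F = (∣ F ∩ A ∣ ≡ᵇ i) ∧ (∣ F ∩ ∁ A ∣ ≡ᵇ j)

countSubsets-meets : ∀ (A : Subset N) i j → countSubsets (meets A i j) ≡ (∣ A ∣ C i) * (∣ ∁ A ∣ C j)
countSubsets-meets []            zero    zero    = refl
countSubsets-meets []            zero    (suc j) = refl
countSubsets-meets []            (suc i) j       = refl
countSubsets-meets {suc N} (inside ∷ A) zero j =
  trans (countSubsets-suc (meets (inside ∷ A) zero j))
    (cong₂ _+_ (countᵇ-false (allSubsets N)) (countSubsets-meets A zero j))
countSubsets-meets {suc N} (inside ∷ A) (suc i) j = begin
  countSubsets (meets (inside ∷ A) (suc i) j)
    ≡⟨ countSubsets-suc (meets (inside ∷ A) (suc i) j) ⟩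
  countSubsets (meets A i j) + countSubsets (meets A (suc i) j)
    ≡⟨ cong₂ _+_ (countSubsets-meets A i j) (countSubsets-meets A (suc i) j) ⟩
  (∣ A ∣ C i) * c + (∣ A ∣ C suc i) * c
    ≡⟨ *-distribʳ-+ c (∣ A ∣ C i) _ ⟨
  (∣ A ∣ C i + ∣ A ∣ C suc i) * c
    ≡⟨ cong (_* c) (nCk+nC[k+1]≡[n+1]C[k+1] ∣ A ∣ i) ⟩
  (suc ∣ A ∣ C suc i) * c ∎
  where open ≡-Reasoning
        c = ∣ ∁ A ∣ C j
countSubsets-meets {suc N} (outside ∷ A) i zero =
  trans (countSubsets-suc (meets (outside ∷ A) i zero))
    (cong₂ _+_ (trans (countᵇ-cong (λ F → ∧-zeroʳ _) (allSubsets N)) (countᵇ-false (allSubsets N)))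
               (countSubsets-meets A i zero))
countSubsets-meets {suc N} (outside ∷ A) i (suc j) = begin
  countSubsets (meets (outside ∷ A) i (suc j))
    ≡⟨ countSubsets-suc (meets (outside ∷ A) i (suc j)) ⟩
  countSubsets (meets A i j) + countSubsets (meets A i (suc j))
    ≡⟨ cong₂ _+_ (countSubsets-meets A i j) (countSubsets-meets A i (suc j)) ⟩
  c * (∣ ∁ A ∣ C j) + c * (∣ ∁ A ∣ C suc j)
    ≡⟨ *-distribˡ-+ c (∣ ∁ A ∣ C j) _ ⟨
  c * (∣ ∁ A ∣ C j + ∣ ∁ A ∣ C suc j)
    ≡⟨ cong (c *_) (nCk+nC[k+1]≡[n+1]C[k+1] ∣ ∁ A ∣ j) ⟩
  c * (suc ∣ ∁ A ∣ C suc j) ∎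
  where open ≡-Reasoning
        c = ∣ A ∣ C i

-- One-dimensional complexes

-- The number of faces with k elements, i.e. f_(k-1).
faceCount : Complex N → ℕ → ℕ
faceCount Δ k = countSubsets (λ F → Δ F ∧ (∣ F ∣ ≡ᵇ k))

maxFaceSize≤ : ∀ (Δ : Complex N) {k} → (∀ F → T (Δ F) → ∣ F ∣ ≤ k) → maxFaceSize Δ ≤ k
maxFaceSize≤ {N} Δ {k} bounded = foldr-preservesᵇ {P = _≤ k} ⊔-lub z≤n
  (All.map⁺ (All.map (bounded _) (All.all-filter (T? ∘ Δ) (allSubsets N))))

∣F∣≤maxFaceSize : ∀ (Δ : Complex N) F → T (Δ F) → ∣ F ∣ ≤ maxFaceSize Δ
∣F∣≤maxFaceSize {N} Δ F F∈Δ = foldr-preservesᵒ {P = ∣ F ∣ ≤_}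
  (λ a b → [ (λ F≤a → ≤-trans F≤a (m≤m⊔n a b)) , (λ F≤b → ≤-trans F≤b (m≤n⊔m a b)) ]′) 0 _
  (inj₂ (Any.map (λ { refl → ≤-refl }) (∈-map⁺ ∣_∣ (∈-filter⁺ (T? ∘ Δ) (∈-allSubsets F) F∈Δ))))

maxFaceSize≡ : ∀ (Δ : Complex N) {k} → (∀ F → T (Δ F) → ∣ F ∣ ≤ k) →
               ∀ F → T (Δ F) → ∣ F ∣ ≡ k → maxFaceSize Δ ≡ k
maxFaceSize≡ Δ bounded F F∈Δ refl = ≤-antisym (maxFaceSize≤ Δ bounded) (∣F∣≤maxFaceSize Δ F F∈Δ)

fVector-dim1 : ∀ (Δ : Complex N) → maxFaceSize Δ ≡ 2 → fVector Δ ≡ faceCount Δ 1 ∷ faceCount Δ 2 ∷ []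
fVector-dim1 Δ dim1 = cong (λ d → map (faceCount Δ ∘ suc) (upTo d)) dim1

-- Edge ideals

pair : Fin N → Fin N → Subset N
pair i j = ⁅ i ⁆ ∪ ⁅ j ⁆

x∈pair⇒ : ∀ {i j : Fin N} → x ∈ pair i j → x ≡ i ⊎ x ≡ j
x∈pair⇒ {i = i} {j} x∈ with x∈p∪q⁻ ⁅ i ⁆ ⁅ j ⁆ x∈
... | inj₁ x∈⁅i⁆ = inj₁ (x∈⁅y⁆⇒x≡y i x∈⁅i⁆)
... | inj₂ x∈⁅j⁆ = inj₂ (x∈⁅y⁆⇒x≡y j x∈⁅j⁆)

i∈pair : ∀ (i j : Fin N) → i ∈ pair i j
i∈pair i j = x∈p∪q⁺ (inj₁ (x∈⁅x⁆ i))

j∈pair : ∀ (i j : Fin N) → j ∈ pair i j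
j∈pair i j = x∈p∪q⁺ (inj₂ (x∈⁅x⁆ j))

pair⊆ : ∀ {i j : Fin N} → i ∈ p → j ∈ p → pair i j ⊆ p
pair⊆ i∈p j∈p x∈ with x∈pair⇒ x∈
... | inj₁ refl = i∈p
... | inj₂ refl = j∈p

∣pair∣≤2 : ∀ (i j : Fin N) → ∣ pair i j ∣ ≤ 2
∣pair∣≤2 i j = ≤-trans (∣p∪q∣≤∣p∣+∣q∣ ⁅ i ⁆ ⁅ j ⁆) (≤-reflexive (cong₂ _+_ (∣⁅x⁆∣≡1 i) (∣⁅x⁆∣≡1 j)))

∣pair∣≡2 : ∀ {i j : Fin N} → i ≢ j → ∣ pair i j ∣ ≡ 2
∣pair∣≡2 {i = i} {j} i≢j = ≤-antisym (∣pair∣≤2 i j) (x≢y⇒1<∣p∣ i≢j (i∈pair i j) (j∈pair i j))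

module EdgeIdeal (G : SimpleGraph N) where

  I : SqFreeMonomialIdeal N
  I = edgeIdeal G

  Edge : Fin N → Fin N → Set
  Edge i j = Adj G i j ≡ true

  edge⇒≢ : ∀ {i j} → Edge i j → i ≢ j
  edge⇒≢ {i} ij refl with trans (sym ij) (irrefl G i)
  ... | ()

  gens⇔ : ∀ g → T (gens I g) ⇔ ∃₂ λ i j → Edge i j × g ≡ pair i j
  gens⇔ g = mk⇔ into onto
    where
    anyFin : ∀ f → T (any f (allFin N)) ⇔ ∃ (T ∘ f)
    anyFin f = T-any⇔∃ f ∈-allFin
    into : T (gens I g) → ∃₂ λ i j → Edge i j × g ≡ pair i j
    into h =
      let i , h′ = to (anyFin _) h
          j , h″ = to (anyFin _) h′
          ij , g≡ = to T-∧ h″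
      in i , j , to T-≡ ij , toWitness g≡
    onto : (∃₂ λ i j → Edge i j × g ≡ pair i j) → T (gens I g)
    onto (i , j , ij , g≡) =
      from (anyFin _) (i , from (anyFin _) (j , from T-∧ (from T-≡ ij , fromWitness g≡)))

  edge⇒∣pair∣≡2 : ∀ {i j} → Edge i j → ∣ pair i j ∣ ≡ 2
  edge⇒∣pair∣≡2 = ∣pair∣≡2 ∘ edge⇒≢

  noProperSubgenerator : ∀ {g h} → T (gens I g) → T (gens I h) → ¬ h ⊂ g
  noProperSubgenerator {g} {h} g-gen h-gen h⊂g with to (gens⇔ g) g-gen | to (gens⇔ h) h-gen
  ... | i , j , _ , refl | k , l , kl , refl =
    <⇒≱ (p⊂q⇒∣p∣<∣q∣ h⊂g) (subst (_ ≤_) (sym (edge⇒∣pair∣≡2 kl)) (∣pair∣≤2 i j))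

  minimalGen≡gens : ∀ g → minimalGen I g ≡ gens I g
  minimalGen≡gens g = T⇔T⇒≡ (proj₁ ∘ to T-∧) λ g-gen → from T-∧ (g-gen , ¬T⇒T-not λ proper →
    let h , h-proper = to (T-any⇔∃ (λ h → gens I h ∧ ⌊ h ⊂? g ⌋) ∈-allSubsets) proper
        h-gen , h⊂g = to T-∧ h-proper
    in noProperSubgenerator g-gen h-gen (toWitness h⊂g))

  inIdeal⇔ : ∀ F → T (inIdeal I F) ⇔ ∃₂ λ i j → Edge i j × i ∈ F × j ∈ F
  inIdeal⇔ F = mk⇔ into onto
    where
    anySubset = T-any⇔∃ (λ g → gens I g ∧ ⌊ g ⊆? F ⌋) ∈-allSubsets
    into : T (inIdeal I F) → ∃₂ λ i j → Edge i j × i ∈ F × j ∈ F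
    into h =
      let g , h′ = to anySubset h
          g-gen , g⊆F = to T-∧ h′
          i , j , ij , g≡ij = to (gens⇔ g) g-gen
          pair⊆F = subst (_⊆ F) g≡ij (toWitness g⊆F)
      in i , j , ij , pair⊆F (i∈pair i j) , pair⊆F (j∈pair i j)
    onto : (∃₂ λ i j → Edge i j × i ∈ F × j ∈ F) → T (inIdeal I F)
    onto (i , j , ij , i∈F , j∈F) = from anySubset
      (pair i j , from T-∧ (from (gens⇔ _) (i , j , ij , refl) , fromWitness (λ {x} → pair⊆ i∈F j∈F {x})))

  facetComplex⇔ : ∀ F → T (facetComplex I F) ⇔ ∃₂ λ i j → Edge i j × F ⊆ pair i j
  facetComplex⇔ F = mk⇔ into onto
    where
    anySubset = T-any⇔∃ (λ g → minimalGen I g ∧ ⌊ F ⊆? g ⌋) ∈-allSubsets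
    into : T (facetComplex I F) → ∃₂ λ i j → Edge i j × F ⊆ pair i j
    into h =
      let g , h′ = to anySubset h
          g-min , F⊆g = to T-∧ h′
          i , j , ij , g≡ij = to (gens⇔ g) (subst T (minimalGen≡gens g) g-min)
      in i , j , ij , subst (λ g → F ⊆ g) g≡ij (toWitness F⊆g)
    onto : (∃₂ λ i j → Edge i j × F ⊆ pair i j) → T (facetComplex I F)
    onto (i , j , ij , F⊆) = from anySubset
      (pair i j , from T-∧ ( subst T (sym (minimalGen≡gens _)) (from (gens⇔ _) (i , j , ij , refl))
                           , fromWitness (λ {x} → F⊆ {x})))

  ∣F∣≤1⇒nonFace : ∀ F → ∣ F ∣ ≤ 1 → T (nonFaceComplex I F)
  ∣F∣≤1⇒nonFace F ∣F∣≤1 = ¬T⇒T-not λ F∈I →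
    let i , j , ij , i∈F , j∈F = to (inIdeal⇔ F) F∈I in <⇒≱ (x≢y⇒1<∣p∣ (edge⇒≢ ij) i∈F j∈F) ∣F∣≤1

  ∣F∣≡1⇒facet : NoIsolatedVertices G → ∀ F → ∣ F ∣ ≡ 1 → T (facetComplex I F)
  ∣F∣≡1⇒facet noIsolated F ∣F∣≡1 =
    let v , v∈F = 0<∣p∣⇒Nonempty F (≤-reflexive (sym ∣F∣≡1))
        w , vw = noIsolated v
        F⊆⁅v⁆ = ∣p∣≤1⇒p⊆⁅x⁆ (≤-reflexive ∣F∣≡1) v∈F
    in from (facetComplex⇔ F) (v , w , vw , p⊆p∪q ⁅ w ⁆ ∘ F⊆⁅v⁆)

  facet⇒∣F∣≤2 : ∀ F → T (facetComplex I F) → ∣ F ∣ ≤ 2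
  facet⇒∣F∣≤2 F F∈Δ =
    let i , j , _ , F⊆ = to (facetComplex⇔ F) F∈Δ in ≤-trans (p⊆q⇒∣p∣≤∣q∣ F⊆) (∣pair∣≤2 i j)

  maxFaceSize-facetComplex : NoIsolatedVertices G → Fin N → maxFaceSize (facetComplex I) ≡ 2
  maxFaceSize-facetComplex noIsolated v =
    let w , vw = noIsolated v
    in maxFaceSize≡ (facetComplex I) facet⇒∣F∣≤2 (pair v w)
         (from (facetComplex⇔ (pair v w)) (v , w , vw , λ x∈ → x∈)) (edge⇒∣pair∣≡2 vw)

  facet≡inIdeal : ∀ F → ∣ F ∣ ≡ 2 → facetComplex I F ≡ inIdeal I F
  facet≡inIdeal F ∣F∣≡2 = T⇔T⇒≡ facet⇒inIdeal inIdeal⇒facet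
    where
    facet⇒inIdeal : T (facetComplex I F) → T (inIdeal I F)
    facet⇒inIdeal F∈Δ =
      let i , j , ij , F⊆ = to (facetComplex⇔ F) F∈Δ
          pair⊆F = p⊆q∧∣q∣≤∣p∣⇒q⊆p F⊆ (≤-reflexive (trans (edge⇒∣pair∣≡2 ij) (sym ∣F∣≡2)))
      in from (inIdeal⇔ F) (i , j , ij , pair⊆F (i∈pair i j) , pair⊆F (j∈pair i j))
    inIdeal⇒facet : T (inIdeal I F) → T (facetComplex I F)
    inIdeal⇒facet F∈I =
      let i , j , ij , i∈F , j∈F = to (inIdeal⇔ F) F∈I
      in from (facetComplex⇔ F)
           (i , j , ij , p⊆q∧∣q∣≤∣p∣⇒q⊆p (pair⊆ i∈F j∈F) (≤-reflexive (trans ∣F∣≡2 (sym (edge⇒∣pair∣≡2 ij)))))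

  -- A non-face of I(G) is an independent set of G, so the hypotheses say that G has independence
  -- number 2.
  isQuasiFGraph-dim1 : NoIsolatedVertices G →
    (∀ F → T (nonFaceComplex I F) → ∣ F ∣ ≤ 2) → ∀ F₂ → T (nonFaceComplex I F₂) → ∣ F₂ ∣ ≡ 2 →
    IsQuasiFGraph G (+ 0 ∷ (+ faceCount (nonFaceComplex I) 2 - + faceCount (facetComplex I) 2) ∷ [])
  isQuasiFGraph-dim1 noIsolated independent⇒∣F∣≤2 F₂ F₂-independent ∣F₂∣≡2 =
    cong length fVector-N , cong length fVector-F ,
    trans (cong₂ (zipWith (λ a b → + a - + b)) fVector-N fVector-F)
          (cong (_∷ (+ faceCount ΔN 2 - + faceCount ΔF 2) ∷ [])
                (trans (cong (λ c → + c - + faceCount ΔF 1) f₀-N≡f₀-F) (+-inverseʳ (+ faceCount ΔF 1))))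
    where
    ΔN = nonFaceComplex I
    ΔF = facetComplex I
    fVector-N = fVector-dim1 ΔN (maxFaceSize≡ ΔN independent⇒∣F∣≤2 F₂ F₂-independent ∣F₂∣≡2)
    fVector-F = fVector-dim1 ΔF (maxFaceSize-facetComplex noIsolated
                                  (proj₁ (0<∣p∣⇒Nonempty F₂ (≤-trans (s≤s z≤n) (≤-reflexive (sym ∣F₂∣≡2))))))
    f₀-N≡f₀-F : faceCount ΔN 1 ≡ faceCount ΔF 1
    f₀-N≡f₀-F = countᵇ-cong (λ F → ∧-congʳ-T (∣ F ∣ ≡ᵇ 1) λ ∣F∣≡ᵇ1 →
        let ∣F∣≡1 = ≡ᵇ⇒≡ ∣ F ∣ 1 ∣F∣≡ᵇ1 in
        trans (to T-≡ (∣F∣≤1⇒nonFace F (≤-reflexive ∣F∣≡1))) (sym (to T-≡ (∣F∣≡1⇒facet noIsolated F ∣F∣≡1))))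
      (allSubsets N)

-- Disjoint unions of two cliques

nonEdgePair≡ : ∀ a b → not ((1 <ᵇ a) ∨ (1 <ᵇ b)) ∧ (a + b ≡ᵇ 2) ≡ (a ≡ᵇ 1) ∧ (b ≡ᵇ 1)
nonEdgePair≡ 0             0             = refl
nonEdgePair≡ 0             1             = refl
nonEdgePair≡ 0             (suc (suc b)) = refl
nonEdgePair≡ 1             0             = refl
nonEdgePair≡ 1             1             = refl
nonEdgePair≡ 1             (suc (suc b)) = refl
nonEdgePair≡ (suc (suc a)) b             = refl

edgePair≡ : ∀ a b → ((1 <ᵇ a) ∨ (1 <ᵇ b)) ∧ (a + b ≡ᵇ 2) ≡ ((a ≡ᵇ 2) ∧ (b ≡ᵇ 0)) ∨ ((a ≡ᵇ 0) ∧ (b ≡ᵇ 2))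
edgePair≡ 0                   0                   = refl
edgePair≡ 0                   1                   = refl
edgePair≡ 0                   2                   = refl
edgePair≡ 0                   (suc (suc (suc b))) = refl
edgePair≡ 1                   0                   = refl
edgePair≡ 1                   1                   = refl
edgePair≡ 1                   (suc (suc b))       = refl
edgePair≡ 2                   0                   = refl
edgePair≡ 2                   (suc b)             = refl
edgePair≡ (suc (suc (suc a))) b                   = refl

disjoint-20-02 : ∀ a b → ((a ≡ᵇ 2) ∧ (b ≡ᵇ 0)) ∧ ((a ≡ᵇ 0) ∧ (b ≡ᵇ 2)) ≡ false
disjoint-20-02 0       b = refl
disjoint-20-02 (suc a) b = ∧-zeroʳ _

module TwoCliques (G : SimpleGraph N) (side : Fin N → Bool)
                  (compl⇔ : ∀ u v → ComplAdj G u v ⇔ (side u ≢ side v)) where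

  open EdgeIdeal G

  S : Subset N
  S = tabulate side

  ∈S⇔ : ∀ {u} → u ∈ S ⇔ side u ≡ true
  ∈S⇔ {u} = mk⇔ (λ u∈S → trans (sym (lookup∘tabulate side u)) ([]=⇒lookup u∈S))
                (λ su → lookup⇒[]= u S (trans (lookup∘tabulate side u) su))

  ∈∁S⇔ : ∀ {u} → u ∈ ∁ S ⇔ side u ≡ false
  ∈∁S⇔ = mk⇔ (λ u∈∁S → ¬-not (x∈∁p⇒x∉p u∈∁S ∘ from ∈S⇔))
             (λ su → x∉p⇒x∈∁p λ u∈S → contradiction (trans (sym (to ∈S⇔ u∈S)) su) λ ())

  edge⇒sameSide : ∀ {u v} → Edge u v → side u ≡ side v
  edge⇒sameSide {u} {v} uv with side u Bool.≟ side v
  ... | yes su≡sv = su≡sv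
  ... | no  su≢sv = contradiction (trans (sym uv) (proj₂ (from (compl⇔ u v) su≢sv))) λ ()

  sameSide⇒edge : ∀ {u v} → u ≢ v → side u ≡ side v → Edge u v
  sameSide⇒edge {u} {v} u≢v su≡sv with Adj G u v in uv
  ... | true  = refl
  ... | false = contradiction su≡sv (to (compl⇔ u v) (u≢v , uv))

  reachable⇒sameSide : ∀ {u v} → Reachable G u v → side u ≡ side v
  reachable⇒sameSide here         = refl
  reachable⇒sameSide (step uv vw) = trans (edge⇒sameSide uv) (reachable⇒sameSide vw)

  sidesDiffer : ∀ {u v} → u ∈ S → v ∈ ∁ S → side u ≢ side v
  sidesDiffer u∈S v∈∁S su≡sv = contradiction (trans (sym (to ∈S⇔ u∈S)) (trans su≡sv (to ∈∁S⇔ v∈∁S))) λ ()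

  disconnected : ∀ {u v} → u ∈ S → v ∈ ∁ S → Disconnected G
  disconnected {u} {v} u∈S v∈∁S connected = sidesDiffer u∈S v∈∁S (reachable⇒sameSide (connected u v))

  sameSide⇒1<∣F∩A∣ : ∀ {F A c i j} → (∀ {x} → side x ≡ c → x ∈ A) →
                     Edge i j → i ∈ F → j ∈ F → side i ≡ c → 1 < ∣ F ∩ A ∣
  sameSide⇒1<∣F∩A∣ side⇒∈A ij i∈F j∈F si≡c = x≢y⇒1<∣p∣ (edge⇒≢ ij)
    (x∈p∩q⁺ (i∈F , side⇒∈A si≡c)) (x∈p∩q⁺ (j∈F , side⇒∈A (trans (sym (edge⇒sameSide ij)) si≡c)))

  1<∣F∩A∣⇒inIdeal : ∀ F {A c} → (∀ {x} → x ∈ A → side x ≡ c) → 1 < ∣ F ∩ A ∣ → T (inIdeal I F)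
  1<∣F∩A∣⇒inIdeal F {A} ∈A⇒side 1<∣F∩A∣ with 1<∣p∣⇒x≢y (F ∩ A) 1<∣F∩A∣
  ... | i , j , i≢j , i∈F∩A , j∈F∩A =
    let i∈F , i∈A = x∈p∩q⁻ F A i∈F∩A
        j∈F , j∈A = x∈p∩q⁻ F A j∈F∩A
    in from (inIdeal⇔ F) (i , j , sameSide⇒edge i≢j (trans (∈A⇒side i∈A) (sym (∈A⇒side j∈A))) , i∈F , j∈F)

  inIdeal⇔1<∣F∩S∣⊎1<∣F∩∁S∣ : ∀ F → T (inIdeal I F) ⇔ (1 < ∣ F ∩ S ∣ ⊎ 1 < ∣ F ∩ ∁ S ∣)
  inIdeal⇔1<∣F∩S∣⊎1<∣F∩∁S∣ F = mk⇔ into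
    [ 1<∣F∩A∣⇒inIdeal F (to ∈S⇔) , 1<∣F∩A∣⇒inIdeal F (to ∈∁S⇔) ]′
    where
    into : T (inIdeal I F) → 1 < ∣ F ∩ S ∣ ⊎ 1 < ∣ F ∩ ∁ S ∣
    into F∈I with to (inIdeal⇔ F) F∈I
    ... | i , j , ij , i∈F , j∈F with side i in si
    ... | true  = inj₁ (sameSide⇒1<∣F∩A∣ (from ∈S⇔) ij i∈F j∈F si)
    ... | false = inj₂ (sameSide⇒1<∣F∩A∣ (from ∈∁S⇔) ij i∈F j∈F si)

  inIdeal≡ : ∀ F → inIdeal I F ≡ (1 <ᵇ ∣ F ∩ S ∣) ∨ (1 <ᵇ ∣ F ∩ ∁ S ∣)
  inIdeal≡ F = T⇔T⇒≡
    (from T-∨ ∘ Sum.map <⇒<ᵇ <⇒<ᵇ ∘ to (inIdeal⇔1<∣F∩S∣⊎1<∣F∩∁S∣ F))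
    (from (inIdeal⇔1<∣F∩S∣⊎1<∣F∩∁S∣ F) ∘ Sum.map (<ᵇ⇒< 1 _) (<ᵇ⇒< 1 _) ∘ to T-∨)

  independent⇒∣F∣≤2 : ∀ F → T (nonFaceComplex I F) → ∣ F ∣ ≤ 2
  independent⇒∣F∣≤2 F F∉I = ≤-trans (≤-reflexive (∣p∣≡∣p∩q∣+∣p∩∁q∣ F S))
    (+-mono-≤ (≮⇒≥ (¬F∈I ∘ from (inIdeal⇔1<∣F∩S∣⊎1<∣F∩∁S∣ F) ∘ inj₁))
              (≮⇒≥ (¬F∈I ∘ from (inIdeal⇔1<∣F∩S∣⊎1<∣F∩∁S∣ F) ∘ inj₂)))
    where
    ¬F∈I : ¬ T (inIdeal I F)
    ¬F∈I = subst T (to T-not-≡ F∉I)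

  crossPair-independent : ∀ {u v} → u ∈ S → v ∈ ∁ S → T (nonFaceComplex I (pair u v))
  crossPair-independent {u} {v} u∈S v∈∁S = ¬T⇒T-not λ uv∈I → noEdge (to (inIdeal⇔ (pair u v)) uv∈I)
    where
    su≢sv = sidesDiffer u∈S v∈∁S
    noEdge : ¬ (∃₂ λ i j → Edge i j × i ∈ pair u v × j ∈ pair u v)
    noEdge (i , j , ij , i∈ , j∈) with x∈pair⇒ i∈ | x∈pair⇒ j∈
    ... | inj₁ refl | inj₁ refl = edge⇒≢ ij refl
    ... | inj₂ refl | inj₂ refl = edge⇒≢ ij refl
    ... | inj₁ refl | inj₂ refl = su≢sv (edge⇒sameSide ij)
    ... | inj₂ refl | inj₁ refl = su≢sv (sym (edge⇒sameSide ij))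

  f₁-nonFaceComplex : faceCount (nonFaceComplex I) 2 ≡ ∣ S ∣ * ∣ ∁ S ∣
  f₁-nonFaceComplex = begin
    faceCount (nonFaceComplex I) 2
      ≡⟨ countᵇ-cong (λ F → trans (cong₂ (λ z s → not z ∧ (s ≡ᵇ 2)) (inIdeal≡ F) (∣p∣≡∣p∩q∣+∣p∩∁q∣ F S))
                                  (nonEdgePair≡ ∣ F ∩ S ∣ ∣ F ∩ ∁ S ∣)) (allSubsets N) ⟩
    countSubsets (meets S 1 1)
      ≡⟨ countSubsets-meets S 1 1 ⟩
    (∣ S ∣ C 1) * (∣ ∁ S ∣ C 1)
      ≡⟨ cong₂ _*_ (nC1≡n ∣ S ∣) (nC1≡n ∣ ∁ S ∣) ⟩
    ∣ S ∣ * ∣ ∁ S ∣ ∎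
    where open ≡-Reasoning

  f₁-facetComplex : faceCount (facetComplex I) 2 ≡ ∣ S ∣ C 2 + ∣ ∁ S ∣ C 2
  f₁-facetComplex = begin
    faceCount (facetComplex I) 2
      ≡⟨ countᵇ-cong (λ F → ∧-congʳ-T (∣ F ∣ ≡ᵇ 2) (facet≡inIdeal F ∘ ≡ᵇ⇒≡ ∣ F ∣ 2)) (allSubsets N) ⟩
    faceCount (inIdeal I) 2
      ≡⟨ countᵇ-cong (λ F → trans (cong₂ (λ z s → z ∧ (s ≡ᵇ 2)) (inIdeal≡ F) (∣p∣≡∣p∩q∣+∣p∩∁q∣ F S))
                                  (edgePair≡ ∣ F ∩ S ∣ ∣ F ∩ ∁ S ∣)) (allSubsets N) ⟩
    countSubsets (λ F → meets S 2 0 F ∨ meets S 0 2 F)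
      ≡⟨ countᵇ-∨ (meets S 2 0) (meets S 0 2) (λ F → disjoint-20-02 ∣ F ∩ S ∣ ∣ F ∩ ∁ S ∣) (allSubsets N) ⟩
    countSubsets (meets S 2 0) + countSubsets (meets S 0 2)
      ≡⟨ cong₂ _+_ (countSubsets-meets S 2 0) (countSubsets-meets S 0 2) ⟩
    (∣ S ∣ C 2) * 1 + 1 * (∣ ∁ S ∣ C 2)
      ≡⟨ cong₂ _+_ (*-identityʳ (∣ S ∣ C 2)) (*-identityˡ (∣ ∁ S ∣ C 2)) ⟩
    ∣ S ∣ C 2 + ∣ ∁ S ∣ C 2 ∎
    where open ≡-Reasoning

  isQuasiFGraph : NoIsolatedVertices G → ∀ {u v} → u ∈ S → v ∈ ∁ S →
    IsQuasiFGraph G (+ 0 ∷ (+ (∣ S ∣ * ∣ ∁ S ∣) - + (∣ S ∣ C 2 + ∣ ∁ S ∣ C 2)) ∷ [])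
  isQuasiFGraph noIsolated {u} {v} u∈S v∈∁S =
    subst (λ d → IsQuasiFGraph G (+ 0 ∷ d ∷ [])) (cong₂ (λ a b → + a - + b) f₁-nonFaceComplex f₁-facetComplex)
      (isQuasiFGraph-dim1 noIsolated independent⇒∣F∣≤2 (pair u v) (crossPair-independent u∈S v∈∁S)
        (∣pair∣≡2 {i = u} {j = v} λ { refl → sidesDiffer u∈S v∈∁S refl }))

2*nC2+n≡n*n : ∀ n → 2 * (n C 2) + n ≡ n * n
2*nC2+n≡n*n zero    = refl
2*nC2+n≡n*n (suc n) = begin
  2 * (suc n C 2) + suc n          ≡⟨ cong (λ c → 2 * c + suc n) (nCk+nC[k+1]≡[n+1]C[k+1] n 1) ⟨
  2 * (n C 1 + n C 2) + suc n      ≡⟨ cong (λ c → 2 * (c + n C 2) + suc n) (nC1≡n n) ⟩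
  2 * (n + n C 2) + suc n          ≡⟨ regroup n (n C 2) ⟩
  2 * (n C 2) + n + (2 * n + 1)    ≡⟨ cong (_+ (2 * n + 1)) (2*nC2+n≡n*n n) ⟩
  n * n + (2 * n + 1)              ≡⟨ square-suc n ⟩
  suc n * suc n                    ∎
  where
  open ≡-Reasoning
  regroup : ∀ n c → 2 * (n + c) + suc n ≡ 2 * c + n + (2 * n + 1)
  regroup = ℕ-solve-∀
  square-suc : ∀ n → n * n + (2 * n + 1) ≡ suc n * suc n
  square-suc = ℕ-solve-∀

2*nC2+n≡n*nᶻ : ∀ n → + 2 *ℤ + (n C 2) +ℤ + n ≡ + n *ℤ + n
2*nC2+n≡n*nᶻ n =
  trans (cong (_+ℤ + n) (sym (pos-* 2 (n C 2)))) (trans (cong +_ (2*nC2+n≡n*n n)) (pos-* n n))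

edgeCountDifference : ∀ {n m r} → n ≡ m + r →
  + 2 *ℤ (+ (n * m) - + (n C 2 + m C 2)) ≡ + (2 * n) - + r - + (r * r)
edgeCountDifference {_} {m} {r} refl = begin
  + 2 *ℤ (+ (n * m) - + (n C 2 + m C 2))
    ≡⟨ cong₂ (λ a b → + 2 *ℤ (a - b)) (pos-* n m) (pos-+ (n C 2) (m C 2)) ⟩
  + 2 *ℤ ((M +ℤ R) *ℤ M - (X +ℤ Y))
    ≡⟨ expand M R X Y ⟩
  + 2 *ℤ (M +ℤ R) *ℤ M +ℤ (M +ℤ R) +ℤ M - (+ 2 *ℤ X +ℤ (M +ℤ R)) - (+ 2 *ℤ Y +ℤ M)
    ≡⟨ cong₂ (λ a b → + 2 *ℤ (M +ℤ R) *ℤ M +ℤ (M +ℤ R) +ℤ M - a - b) (2*nC2+n≡n*nᶻ n) (2*nC2+n≡n*nᶻ m) ⟩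
  + 2 *ℤ (M +ℤ R) *ℤ M +ℤ (M +ℤ R) +ℤ M - (M +ℤ R) *ℤ (M +ℤ R) - M *ℤ M
    ≡⟨ collapse M R ⟩
  + 2 *ℤ (M +ℤ R) - R - R *ℤ R
    ≡⟨ cong₂ (λ a b → a - R - b) (pos-* 2 n) (pos-* r r) ⟨
  + (2 * n) - + r - + (r * r) ∎
  where
  open ≡-Reasoning
  n = m + r
  M = + m
  R = + r
  X = + (n C 2)
  Y = + (m C 2)
  expand : ∀ M R X Y → + 2 *ℤ ((M +ℤ R) *ℤ M - (X +ℤ Y)) ≡
           + 2 *ℤ (M +ℤ R) *ℤ M +ℤ (M +ℤ R) +ℤ M - (+ 2 *ℤ X +ℤ (M +ℤ R)) - (+ 2 *ℤ Y +ℤ M)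
  expand = ℤ-solve-∀
  collapse : ∀ M R → + 2 *ℤ (M +ℤ R) *ℤ M +ℤ (M +ℤ R) +ℤ M - (M +ℤ R) *ℤ (M +ℤ R) - M *ℤ M ≡
             + 2 *ℤ (M +ℤ R) - R - R *ℤ R
  collapse = ℤ-solve-∀

corollary4p4 : (n r : ℕ) → 1 < r → r < n → 4 ≤ n →
    {N : ℕ} (G : SimpleGraph N) → Is[ n ∶ n ∸ r ]-graph G → NoIsolatedVertices G →
    (b : ℤ) → + 2 *ℤ b ≡ + (2 * n) - + r - + (r * r) →
    Disconnected G × IsQuasiFGraph G (+ 0 ∷ b ∷ [])
corollary4p4 n r _ r<n 4≤n G (side , ∣S∣≡n , ∣¬side∣≡n∸r , compl⇔) noIsolated b 2b≡ =
  disconnected u∈S v∈∁S ,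
  subst (λ d → IsQuasiFGraph G (+ 0 ∷ d ∷ [])) difference≡b (isQuasiFGraph noIsolated u∈S v∈∁S)
  where
  open TwoCliques G side compl⇔
  ∣∁S∣≡n∸r : ∣ ∁ S ∣ ≡ n ∸ r
  ∣∁S∣≡n∸r = trans (cong ∣_∣ (sym (tabulate-∘ not side))) ∣¬side∣≡n∸r
  u∈S = proj₂ (0<∣p∣⇒Nonempty S (subst (0 <_) (sym ∣S∣≡n) (≤-trans (s≤s z≤n) 4≤n)))
  v∈∁S = proj₂ (0<∣p∣⇒Nonempty (∁ S) (subst (0 <_) (sym ∣∁S∣≡n∸r) (m<n⇒0<n∸m r<n)))
  difference≡b : + (∣ S ∣ * ∣ ∁ S ∣) - + (∣ S ∣ C 2 + ∣ ∁ S ∣ C 2) ≡ b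
  difference≡b rewrite ∣S∣≡n | ∣∁S∣≡n∸r =
    *-cancelˡ-≡ (+ 2) _ _ (trans (edgeCountDifference (sym (m∸n+n≡m (<⇒≤ r<n)))) (sym 2b≡))
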